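{- Let $\rho$, $\omega_f$, $\lambda(\rho)$ and $\gamma_\rho$ be as in the context. The $W_0$-orbit $\gamma_\rho$ depends only on the isomorphism class of the irreducible representation $\rho$; that is, it does not depend on the choices made in its definition.
   Context: Let $F$ be a non-archimedean local field with residue field $\mathbb{F}_q$, $q=p^f$. Let $\mathcal{I}$ and $\mathcal{P}$ be the inertia and wild inertia subgroups of $\mathrm{Gal}(\overline{F}/F)$, $v\in\mathcal{I}$ a lift of a topological generator of $\mathcal{I}/\mathcal{P}$, and $\mathcal{W}$ the Weil group. Let $\omega_n:\mathcal{W}/\mathcal{P}\simeq\varprojlim\mathbb{F}_{p^n}^\times\to\mathbb{F}_{p^n}^\times\subset\overline{\mathbb{F}}_q^\times$ be the projections, where the limit is along norm maps. The character $\omega_f$ extends to $\mathrm{Gal}(\overline{F}/F)$ (fixing a uniformizer $\varpi$) and is viewed as a character of $F^\times$ by local class field theory, normalized so that geometric Frobenius maps to $\varpi$. One has $\omega_{2f}^{q+1}=\omega_f$, and $\omega_{2f}(v)$ generates $\mathbb{F}_{q^2}^\times$. The restriction of $\omega_f^{m}$ to $\mu_{q-1}(F)\simeq\mathbb{F}_q^\times$ is $x\mapsto x^{m}$. For an irreducible smooth $\rho:\mathrm{Gal}(\overline{F}/F)\to GL_2(\overline{\mathbb{F}}_q)$, $\rho(v)$ has eigenvalues $y,y^q$ with $y\in\mathbb{F}_{q^2}\setminus\mathbb{F}_q$. An exponent of $\rho$ is an integer $1\le h\le q^2-1$ with $\omega_{2f}(v)^h$ an eigenvalue of $\rho(v)$.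 There exist $0\le i\le q-2$ and an exponent $1\le h\le q-1$ of $\rho\otimes\omega_f^{ -i}$. For such a choice, let $\lambda(\rho)$ be the character of $\mathbb{T}=\mu_{q-1}(F)^2\simeq(\mathbb{F}_q^\times)^2$ given by $$(t_1,t_2)\mapsto\omega_f^{h-1+i}(t_1)\,\omega_f^{i}(t_2).$$ Let $W_0=\{1,s\}$ act on characters of $\mathbb{T}$ by ${}^s\lambda(t_1,t_2)=\lambda(t_2,t_1)$. Let $\gamma_\rho$ be the $W_0$-orbit of $\lambda(\rho)$. -}

module Defs where

-- Fix q = p^f.  z := ω_{2f}(v) generates the cyclic group F_{q²}^× of order
-- N = q² - 1, so every element of F_{q²}^× is z^e for an exponent e ∈ ℤ / N.
-- ω_f(v) = ω_{2f}(v)^{q+1} = z^{q+1}.  A character of 𝕋 = (F_q^×)² is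
-- (t₁,t₂) ↦ t₁^a t₂^b with (a,b) ∈ (ℤ/(q-1))², since F_q^× is cyclic of order q-1
-- and ω_f^m restricted to μ_{q-1}(F) is x ↦ x^m.

open import Data.Nat using (ℕ; suc; _≤_; _<_; _∸_) renaming (_*_ to _*ℕ_; _+_ to _+ℕ_)
open import Data.Integer using (ℤ; +_; _-_; _+_; _*_)
open import Data.Integer.Divisibility using (_∣_)
open import Data.Product using (_×_; _,_; proj₁; proj₂)
open import Data.Sum using (_⊎_)
open import Relation.Nullary using (¬_)

_≡_[mod_] : ℤ → ℤ → ℕ → Set
a ≡ b [mod n ] = (+ n) ∣ (a - b)

N : ℕ → ℕ
N q = q *ℕ q ∸ 1

-- z^e ∉ F_q, i.e. (z^e)^{q-1} ≠ 1, i.e. e(q-1) ≢ 0 mod (q²-1)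
NotInFq : ℕ → ℤ → Set
NotInFq q e = ¬ ((e * + (q ∸ 1)) ≡ + 0 [mod N q ])

-- z^x is an eigenvalue of ρ(v), where ρ(v) has eigenvalues z^e, z^{qe}
IsEigenExp : ℕ → ℤ → ℤ → Set
IsEigenExp q e x = (x ≡ e [mod N q ]) ⊎ (x ≡ (+ q) * e [mod N q ])

-- h is an exponent of ρ ⊗ ω_f^{-i}: 1 ≤ h ≤ q²-1 and
-- z^h = ω_{2f}(v)^h is an eigenvalue of (ρ ⊗ ω_f^{-i})(v), whose eigenvalues are
-- z^{e - i(q+1)}, z^{qe - i(q+1)}
IsExponentTwist : ℕ → ℤ → ℕ → ℕ → Set
IsExponentTwist q e i h =
  (1 ≤ h) × (h ≤ N q) × IsEigenExp q e (+ h + (+ i) * (+ (q +ℕ 1)))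

Admissible : ℕ → ℤ → ℕ → ℕ → Set
Admissible q e i h = (i ≤ q ∸ 2) × (1 ≤ h) × (h ≤ q ∸ 1) × IsExponentTwist q e i h

Char : Set
Char = ℤ × ℤ

_≈[_]_ : Char → ℕ → Char → Set
(a , b) ≈[ q ] (c , d) = (a ≡ c [mod q ∸ 1 ]) × (b ≡ d [mod q ∸ 1 ])

lam : ℕ → ℕ → Char
lam i h = ((+ h - + 1) + + i , + i)

sAct : Char → Char
sAct (a , b) = (b , a)

InOrbit : ℕ → Char → Char → Set
InOrbit q μ ν = (μ ≈[ q ] ν) ⊎ (μ ≈[ q ] sAct ν)

{-# OPTIONS --safe #-}
-- The eigen-exponents of ρ(v) form one orbit {X, qX} of multiplication by q modulo
-- N = q² - 1 = (q + 1)(q - 1).  Writing X = h + i(q + 1) with 1 ≤ h ≤ q - 1, reduction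
-- mod q + 1 recovers h from X, and cancelling q + 1 recovers i mod q - 1, so choices
-- attached to the same exponent give the same λ.  The conjugate exponent satisfies
-- qX ≡ (q + 1 - h) + (i + h - 1)(q + 1) mod N, so it corresponds to the choice
-- (i + h - 1, q + 1 - h), whose λ is s·λ modulo q - 1.
module Submission where

open import Defs
open import Data.Nat using (ℕ; _≤_; _^_)
open import Data.Nat.Primality using (Prime)
open import Data.Integer using (ℤ)
open import Function.Bundles using (_⇔_)

open import Data.Nat as ℕ using (_<_; NonZero)
import Data.Nat.Properties as ℕP
import Data.Nat.Divisibility as ℕD
open import Data.Integer using (+_; -_; _+_; _-_; _*_; ∣_∣)
import Data.Integer.Properties as ℤP
import Data.Integer.Divisibility.Signed as ℤS
open import Data.Integer.Tactic.RingSolver using (solve-∀)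
import Data.Nat.Tactic.RingSolver as ℕSolver
open import Data.Product using (_,_; swap)
open import Data.Sum using (inj₁; inj₂)
open import Function.Bundles using (mk⇔)
open import Level using (0ℓ)
open import Relation.Binary.Bundles using (Setoid)
open import Relation.Binary.PropositionalEquality using (_≡_; refl; sym; trans; cong; subst; subst₂; cong₂; module ≡-Reasoning)
open import Relation.Nullary using (contradiction)

-- `_≡_[mod_]` unfolds to divisibility of an absolute value, from which Agda cannot
-- infer a and b; this record keeps them as indices.
infix 4 _≡_⟨mod_⟩
record _≡_⟨mod_⟩ (a b : ℤ) (n : ℕ) : Set where
  constructor modular
  field
    divides-difference : (+ n) ℤS.∣ (a - b)

open _≡_⟨mod_⟩

fromMod : ∀ {n a b} → a ≡ b [mod n ] → a ≡ b ⟨mod n ⟩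
fromMod {n} {a} {b} p = modular (ℤS.∣ᵤ⇒∣ {+ n} {a - b} p)

toMod : ∀ {n a b} → a ≡ b ⟨mod n ⟩ → a ≡ b [mod n ]
toMod p = ℤS.∣⇒∣ᵤ (divides-difference p)

module _ {n : ℕ} where

  private
    by : ∀ {a b x} → x ≡ a - b → (+ n) ℤS.∣ x → a ≡ b ⟨mod n ⟩
    by eq n∣x = modular (subst ((+ n) ℤS.∣_) eq n∣x)

  mod-reflexive : ∀ {a b} → a ≡ b → a ≡ b ⟨mod n ⟩
  mod-reflexive {a} refl = by (sym (ℤP.+-inverseʳ a)) (ℤS.divides (+ 0) refl)

  mod-sym : ∀ {a b} → a ≡ b ⟨mod n ⟩ → b ≡ a ⟨mod n ⟩
  mod-sym {a} {b} (modular p) = by (negated a b) (ℤS.∣m⇒∣-m p)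
    where
    negated : ∀ a b → - (a - b) ≡ b - a
    negated = solve-∀

  mod-trans : ∀ {a b c} → a ≡ b ⟨mod n ⟩ → b ≡ c ⟨mod n ⟩ → a ≡ c ⟨mod n ⟩
  mod-trans {a} {b} {c} (modular p) (modular q) = by (telescope a b c) (ℤS.∣m∣n⇒∣m+n p q)
    where
    telescope : ∀ a b c → (a - b) + (b - c) ≡ a - c
    telescope = solve-∀

  mod-setoid : Setoid 0ℓ 0ℓ
  mod-setoid = record
    { Carrier = ℤ
    ; _≈_ = _≡_⟨mod n ⟩
    ; isEquivalence = record { refl = mod-reflexive refl ; sym = mod-sym ; trans = mod-trans }
    }

  +-congˡ-mod : ∀ {a b} k → a ≡ b ⟨mod n ⟩ → k + a ≡ k + b ⟨mod n ⟩
  +-congˡ-mod {a} {b} k (modular p) = by (cancel k a b) p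
    where
    cancel : ∀ k a b → a - b ≡ (k + a) - (k + b)
    cancel = solve-∀

  *-congˡ-mod : ∀ {a b} k → a ≡ b ⟨mod n ⟩ → k * a ≡ k * b ⟨mod n ⟩
  *-congˡ-mod {a} {b} k (modular p) = by (distrib k a b) (ℤS.∣n⇒∣m*n k p)
    where
    distrib : ∀ k a b → k * (a - b) ≡ k * a - k * b
    distrib = solve-∀

  *-congʳ-mod : ∀ {a b} k → a ≡ b ⟨mod n ⟩ → a * k ≡ b * k ⟨mod n ⟩
  *-congʳ-mod {a} {b} k (modular p) = by (distrib k a b) (ℤS.∣m⇒∣m*n k p)
    where
    distrib : ∀ k a b → (a - b) * k ≡ a * k - b * k
    distrib = solve-∀

  +-cancelˡ-mod : ∀ {a b} c → c + a ≡ c + b ⟨mod n ⟩ → a ≡ b ⟨mod n ⟩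
  +-cancelˡ-mod {a} {b} c (modular p) = by (cancel c a b) p
    where
    cancel : ∀ c a b → (c + a) - (c + b) ≡ a - b
    cancel = solve-∀

  +-multiple-mod : ∀ a k → a + k * + n ≡ a ⟨mod n ⟩
  +-multiple-mod a k = by (difference a k (+ n)) (ℤS.∣n⇒∣m*n k (ℤS.∣-refl {+ n}))
    where
    difference : ∀ a k n → k * n ≡ (a + k * n) - a
    difference = solve-∀

*-cancelˡ-mod : ∀ {n a b} m .{{_ : NonZero m}} → + m * a ≡ + m * b ⟨mod m ℕ.* n ⟩ → a ≡ b ⟨mod n ⟩
*-cancelˡ-mod {n} {a} {b} m (modular p) =
  modular (ℤS.*-cancelˡ-∣ (+ m) (subst₂ ℤS._∣_ (ℤP.pos-* m n) (distrib (+ m) a b) p))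
  where
  distrib : ∀ k a b → k * a - k * b ≡ k * (a - b)
  distrib = solve-∀

mod-∣ : ∀ {m n a b} → m ℕD.∣ n → a ≡ b ⟨mod n ⟩ → a ≡ b ⟨mod m ⟩
mod-∣ {m} {n} m∣n (modular p) = modular (ℤS.∣-trans (ℤS.∣ᵤ⇒∣ {+ m} {+ n} m∣n) p)

∣∧<⇒≡0 : ∀ {n d} → n ℕD.∣ d → d < n → d ≡ 0
∣∧<⇒≡0 {d = ℕ.zero} _ _ = refl
∣∧<⇒≡0 {d = ℕ.suc _} n∣d d<n = contradiction (ℕD.∣⇒≤ n∣d) (ℕP.<⇒≱ d<n)

<∧mod⇒≡ : ∀ {n a b} → a < n → b < n → + a ≡ + b ⟨mod n ⟩ → a ≡ b
<∧mod⇒≡ {n} {a} {b} a<n b<n p =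
  ℤP.+-injective (ℤP.i-j≡0⇒i≡j (+ a) (+ b) (ℤP.∣i∣≡0⇒i≡0 (∣∧<⇒≡0 (toMod p) distance<n)))
  where
  distance<n : ∣ + a - + b ∣ < n
  distance<n = subst (_< n) (cong ∣_∣ (sym (ℤP.m-n≡m⊖n a b)))
                 (ℕP.≤-<-trans (ℤP.∣m⊝n∣≤m⊔n a b) (ℕP.⊔-lub a<n b<n))

pos-∸ : ∀ {m n} → n ≤ m → + (m ℕ.∸ n) ≡ + m - + n
pos-∸ {m} {n} n≤m = sym (trans (ℤP.m-n≡m⊖n m n) (ℤP.⊖-≥ n≤m))

q²≡1 : ∀ {q} → 1 ≤ q → + q * + q ≡ + 1 ⟨mod N q ⟩
q²≡1 {q} 1≤q = modular (ℤS.divides (+ 1) (begin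
  + q * + q - + 1   ≡⟨ cong (_- + 1) (sym (ℤP.pos-* q q)) ⟩
  + (q ℕ.* q) - + 1 ≡⟨ sym (pos-∸ (ℕP.*-mono-≤ 1≤q 1≤q)) ⟩
  + N q             ≡⟨ sym (ℤP.*-identityˡ (+ N q)) ⟩
  + 1 * + N q       ∎))
  where open ≡-Reasoning

module _ {q : ℕ} (1≤q : 1 ≤ q) where

  open import Relation.Binary.Reasoning.Setoid (mod-setoid {N q})

  q*[q*a]≡a : ∀ a → + q * (+ q * a) ≡ a ⟨mod N q ⟩
  q*[q*a]≡a a = begin
    + q * (+ q * a) ≡⟨ ℤP.*-assoc (+ q) (+ q) a ⟨
    + q * + q * a   ≈⟨ *-congʳ-mod a (q²≡1 1≤q) ⟩
    + 1 * a         ≡⟨ ℤP.*-identityˡ a ⟩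
    a               ∎

  IsEigenExp-sym : ∀ {e x} → IsEigenExp q e x → IsEigenExp q x e
  IsEigenExp-sym {e} {x} (inj₁ x≡e) = inj₁ (toMod (mod-sym (fromMod {a = x} {b = e} x≡e)))
  IsEigenExp-sym {e} {x} (inj₂ x≡qe) = inj₂ (toMod (begin
    e               ≈⟨ q*[q*a]≡a e ⟨
    + q * (+ q * e) ≈⟨ *-congˡ-mod (+ q) (fromMod {a = x} {b = + q * e} x≡qe) ⟨
    + q * x         ∎))

  IsEigenExp-trans : ∀ {e x y} → IsEigenExp q e x → IsEigenExp q x y → IsEigenExp q e y
  IsEigenExp-trans {e} {x} {y} (inj₁ x≡e) (inj₁ y≡x) = inj₁ (toMod (begin
    y ≈⟨ fromMod y≡x ⟩
    x ≈⟨ fromMod x≡e ⟩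
    e ∎))
  IsEigenExp-trans {e} {x} {y} (inj₁ x≡e) (inj₂ y≡qx) = inj₂ (toMod (begin
    y       ≈⟨ fromMod y≡qx ⟩
    + q * x ≈⟨ *-congˡ-mod (+ q) (fromMod {a = x} {b = e} x≡e) ⟩
    + q * e ∎))
  IsEigenExp-trans {e} {x} {y} (inj₂ x≡qe) (inj₁ y≡x) = inj₂ (toMod (begin
    y       ≈⟨ fromMod y≡x ⟩
    x       ≈⟨ fromMod x≡qe ⟩
    + q * e ∎))
  IsEigenExp-trans {e} {x} {y} (inj₂ x≡qe) (inj₂ y≡qx) = inj₁ (toMod (begin
    y               ≈⟨ fromMod y≡qx ⟩
    + q * x         ≈⟨ *-congˡ-mod (+ q) (fromMod {a = x} {b = + q * e} x≡qe) ⟩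
    + q * (+ q * e) ≈⟨ q*[q*a]≡a e ⟩
    e               ∎))

≈-sym : ∀ {q μ ν} → μ ≈[ q ] ν → ν ≈[ q ] μ
≈-sym {μ = a , b} {c , d} (a≡c , b≡d) =
  toMod (mod-sym (fromMod {a = a} {b = c} a≡c)) , toMod (mod-sym (fromMod {a = b} {b = d} b≡d))

≈-trans : ∀ {q μ ν κ} → μ ≈[ q ] ν → ν ≈[ q ] κ → μ ≈[ q ] κ
≈-trans {μ = a , b} {c , d} {e , f} (a≡c , b≡d) (c≡e , d≡f) =
  toMod (mod-trans (fromMod {a = a} {b = c} a≡c) (fromMod {a = c} {b = e} c≡e)) ,
  toMod (mod-trans (fromMod {a = b} {b = d} b≡d) (fromMod {a = d} {b = f} d≡f))

InOrbit-sym : ∀ {q μ ν} → InOrbit q μ ν → InOrbit q ν μ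
InOrbit-sym {q} {μ} {ν} (inj₁ μ≈ν) = inj₁ (≈-sym {q} {μ} {ν} μ≈ν)
InOrbit-sym {q} {μ} {ν} (inj₂ μ≈sν) = inj₂ (≈-sym {q} {sAct μ} {ν} (swap μ≈sν))

InOrbit-trans : ∀ {q μ ν κ} → InOrbit q μ ν → InOrbit q ν κ → InOrbit q μ κ
InOrbit-trans {q} {μ} {ν} {κ} (inj₁ μ≈ν) (inj₁ ν≈κ) = inj₁ (≈-trans {q} {μ} {ν} {κ} μ≈ν ν≈κ)
InOrbit-trans {q} {μ} {ν} {κ} (inj₁ μ≈ν) (inj₂ ν≈sκ) = inj₂ (≈-trans {q} {μ} {ν} {sAct κ} μ≈ν ν≈sκ)
InOrbit-trans {q} {μ} {ν} {κ} (inj₂ μ≈sν) (inj₁ ν≈κ) = inj₂ (≈-trans {q} {μ} {sAct ν} {sAct κ} μ≈sν (swap ν≈κ))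
InOrbit-trans {q} {μ} {ν} {κ} (inj₂ μ≈sν) (inj₂ ν≈sκ) = inj₁ (≈-trans {q} {μ} {sAct ν} {κ} μ≈sν (swap ν≈sκ))

InOrbit-⇔ : ∀ {q ν κ} μ → InOrbit q ν κ → InOrbit q μ ν ⇔ InOrbit q μ κ
InOrbit-⇔ {q} {ν} {κ} μ ν∼κ =
  mk⇔ (λ μ∼ν → InOrbit-trans {q} {μ} {ν} {κ} μ∼ν ν∼κ)
      (λ μ∼κ → InOrbit-trans {q} {μ} {κ} {ν} μ∼κ (InOrbit-sym {q} {ν} {κ} ν∼κ))

N-factorisation : ∀ q → N q ≡ (q ℕ.+ 1) ℕ.* (q ℕ.∸ 1)
N-factorisation ℕ.zero = refl
N-factorisation (ℕ.suc m) = expand m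
  where
  expand : ∀ m → m ℕ.+ m ℕ.* ℕ.suc m ≡ (ℕ.suc m ℕ.+ 1) ℕ.* m
  expand = ℕSolver.solve-∀

pos-N : ∀ {q} → 1 ≤ q → + N q ≡ (+ q + + 1) * (+ q - + 1)
pos-N {q} 1≤q = begin
  + N q                             ≡⟨ cong +_ (N-factorisation q) ⟩
  + ((q ℕ.+ 1) ℕ.* (q ℕ.∸ 1))       ≡⟨ ℤP.pos-* (q ℕ.+ 1) (q ℕ.∸ 1) ⟩
  + (q ℕ.+ 1) * + (q ℕ.∸ 1)         ≡⟨ cong₂ _*_ (ℤP.pos-+ q 1) (pos-∸ 1≤q) ⟩
  (+ q + + 1) * (+ q - + 1)         ∎
  where open ≡-Reasoning

twistExponent : ℕ → ℕ → ℕ → ℤ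
twistExponent q i h = + h + + i * + (q ℕ.+ 1)

twistExponent≡⇒h≡ : ∀ {q i h i' h'} → h ≤ q → h' ≤ q →
  twistExponent q i' h' ≡ twistExponent q i h ⟨mod N q ⟩ → h' ≡ h
twistExponent≡⇒h≡ {q} {i} {h} {i'} {h'} h≤q h'≤q X'≡X = <∧mod⇒≡ (≤⇒<+1 h'≤q) (≤⇒<+1 h≤q) (begin
  + h'                  ≈⟨ +-multiple-mod (+ h') (+ i') ⟨
  twistExponent q i' h' ≈⟨ mod-∣ q+1∣N X'≡X ⟩
  twistExponent q i h   ≈⟨ +-multiple-mod (+ h) (+ i) ⟩
  + h                   ∎)
  where
  open import Relation.Binary.Reasoning.Setoid (mod-setoid {q ℕ.+ 1})
  ≤⇒<+1 : ∀ {m} → m ≤ q → m < q ℕ.+ 1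
  ≤⇒<+1 m≤q = ℕP.≤-<-trans m≤q (ℕP.m<m+n q ℕP.0<1+n)
  q+1∣N : (q ℕ.+ 1) ℕD.∣ N q
  q+1∣N = ℕD.divides (q ℕ.∸ 1) (trans (N-factorisation q) (ℕP.*-comm (q ℕ.+ 1) (q ℕ.∸ 1)))

twistExponent≡⇒i≡ : ∀ {q i i' h} →
  twistExponent q i' h ≡ twistExponent q i h ⟨mod N q ⟩ → + i' ≡ + i ⟨mod q ℕ.∸ 1 ⟩
twistExponent≡⇒i≡ {q} {i} {i'} {h} X'≡X = *-cancelˡ-mod (q ℕ.+ 1) {{nonZero}} (begin
  + (q ℕ.+ 1) * + i'   ≡⟨ ℤP.*-comm (+ (q ℕ.+ 1)) (+ i') ⟩
  + i' * + (q ℕ.+ 1)   ≈⟨ +-cancelˡ-mod (+ h) X'≡X′ ⟩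
  + i * + (q ℕ.+ 1)    ≡⟨ ℤP.*-comm (+ i) (+ (q ℕ.+ 1)) ⟩
  + (q ℕ.+ 1) * + i    ∎)
  where
  open import Relation.Binary.Reasoning.Setoid (mod-setoid {(q ℕ.+ 1) ℕ.* (q ℕ.∸ 1)})
  nonZero : NonZero (q ℕ.+ 1)
  nonZero = ℕ.≢-nonZero (ℕP.m+1+n≢0 q)
  X'≡X′ : twistExponent q i' h ≡ twistExponent q i h ⟨mod (q ℕ.+ 1) ℕ.* (q ℕ.∸ 1) ⟩
  X'≡X′ = subst (twistExponent q i' h ≡ twistExponent q i h ⟨mod_⟩) (N-factorisation q) X'≡X

twistExponent≡⇒lam≈ : ∀ {q i h i' h'} → h ≤ q → h' ≤ q →
  twistExponent q i' h' ≡ twistExponent q i h ⟨mod N q ⟩ → lam i' h' ≈[ q ] lam i h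
twistExponent≡⇒lam≈ {q} {i} {h} {i'} {h'} h≤q h'≤q X'≡X =
  subst (λ x → lam i' x ≈[ q ] lam i h) (sym h'≡h) (toMod (+-congˡ-mod (+ h - + 1) i'≡i) , toMod i'≡i)
  where
  h'≡h : h' ≡ h
  h'≡h = twistExponent≡⇒h≡ {q} {i} {h} {i'} {h'} h≤q h'≤q X'≡X
  i'≡i : + i' ≡ + i ⟨mod q ℕ.∸ 1 ⟩
  i'≡i = twistExponent≡⇒i≡ {q} {i} {i'} {h} (subst (λ x → twistExponent q i' x ≡ twistExponent q i h ⟨mod N q ⟩) h'≡h X'≡X)

q*twistExponent : ∀ {q} i k → ℕ.suc k ≤ q →
  + q * twistExponent q i (ℕ.suc k) ≡ twistExponent q (k ℕ.+ i) (q ℕ.∸ k) ⟨mod N q ⟩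
q*twistExponent {q} i k k<q = mod-trans (mod-reflexive expand) (+-multiple-mod _ (+ i))
  where
  open ≡-Reasoning
  polynomial : ∀ q k i → q * ((+ 1 + k) + i * (q + + 1)) ≡ ((q - k) + (k + i) * (q + + 1)) + i * ((q + + 1) * (q - + 1))
  polynomial = solve-∀
  expand : + q * twistExponent q i (ℕ.suc k) ≡ twistExponent q (k ℕ.+ i) (q ℕ.∸ k) + + i * + N q
  expand = begin
    + q * twistExponent q i (ℕ.suc k)
      ≡⟨ cong₂ (λ a b → + q * (a + + i * b)) (ℤP.pos-+ 1 k) (ℤP.pos-+ q 1) ⟩
    + q * ((+ 1 + + k) + + i * (+ q + + 1))
      ≡⟨ polynomial (+ q) (+ k) (+ i) ⟩
    ((+ q - + k) + (+ k + + i) * (+ q + + 1)) + + i * ((+ q + + 1) * (+ q - + 1))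
      ≡⟨ cong₂ (λ a b → (a + b) + + i * ((+ q + + 1) * (+ q - + 1)))
               (sym (pos-∸ (ℕP.<⇒≤ k<q))) (cong₂ _*_ (sym (ℤP.pos-+ k i)) (sym (ℤP.pos-+ q 1))) ⟩
    twistExponent q (k ℕ.+ i) (q ℕ.∸ k) + + i * ((+ q + + 1) * (+ q - + 1))
      ≡⟨ cong (λ n → twistExponent q (k ℕ.+ i) (q ℕ.∸ k) + + i * n) (sym (pos-N (ℕP.≤-trans (ℕ.s≤s ℕ.z≤n) k<q))) ⟩
    twistExponent q (k ℕ.+ i) (q ℕ.∸ k) + + i * + N q
      ∎

lam-conjugate : ∀ {q} i k → ℕ.suc k ≤ q → lam (k ℕ.+ i) (q ℕ.∸ k) ≈[ q ] sAct (lam i (ℕ.suc k))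
lam-conjugate {q} i k k<q =
  toMod (mod-trans (mod-reflexive fst≡) (+-multiple-mod (+ i) (+ 1))) , toMod (mod-reflexive snd≡)
  where
  open ≡-Reasoning
  fst≡ : (+ (q ℕ.∸ k) - + 1) + + (k ℕ.+ i) ≡ + i + + 1 * + (q ℕ.∸ 1)
  fst≡ = begin
    (+ (q ℕ.∸ k) - + 1) + + (k ℕ.+ i)
      ≡⟨ cong₂ (λ a b → (a - + 1) + b) (pos-∸ (ℕP.<⇒≤ k<q)) (ℤP.pos-+ k i) ⟩
    ((+ q - + k) - + 1) + (+ k + + i)
      ≡⟨ regroup (+ q) (+ k) (+ i) ⟩
    + i + + 1 * (+ q - + 1)
      ≡⟨ cong (λ a → + i + + 1 * a) (sym (pos-∸ (ℕP.≤-trans (ℕ.s≤s ℕ.z≤n) k<q))) ⟩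
    + i + + 1 * + (q ℕ.∸ 1)
      ∎
    where
    regroup : ∀ q k i → ((q - k) - + 1) + (k + i) ≡ i + + 1 * (q - + 1)
    regroup = solve-∀
  snd≡ : + (k ℕ.+ i) ≡ (+ ℕ.suc k - + 1) + + i
  snd≡ = begin
    + (k ℕ.+ i)             ≡⟨ ℤP.pos-+ k i ⟩
    + k + + i               ≡⟨ regroup (+ k) (+ i) ⟩
    ((+ 1 + + k) - + 1) + + i ≡⟨ cong (λ a → (a - + 1) + + i) (ℤP.pos-+ 1 k) ⟨
    (+ ℕ.suc k - + 1) + + i ∎
    where
    regroup : ∀ k i → k + i ≡ ((+ 1 + k) - + 1) + i
    regroup = solve-∀

IsEigenExp⇒lam-InOrbit : ∀ {q i k i' h'} → ℕ.suc k ≤ q → h' ≤ q →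
  IsEigenExp q (twistExponent q i (ℕ.suc k)) (twistExponent q i' h') →
  InOrbit q (lam i' h') (lam i (ℕ.suc k))
IsEigenExp⇒lam-InOrbit {i = i} {i' = i'} h≤q h'≤q (inj₁ X'≡X) =
  inj₁ (twistExponent≡⇒lam≈ {i = i} {i' = i'} h≤q h'≤q (fromMod X'≡X))
IsEigenExp⇒lam-InOrbit {q} {i} {k} {i'} {h'} h≤q h'≤q (inj₂ X'≡qX) =
  inj₂ (≈-trans {q} {lam i' h'} {lam (k ℕ.+ i) (q ℕ.∸ k)} {sAct (lam i (ℕ.suc k))}
    (twistExponent≡⇒lam≈ {i = k ℕ.+ i} {i' = i'} (ℕP.m∸n≤m q k) h'≤q
      (mod-trans (fromMod X'≡qX) (q*twistExponent i k h≤q)))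
    (lam-conjugate i k h≤q))

Admissible⇒InOrbit : ∀ {q e e' i h i' h'} → IsEigenExp q e e' →
  Admissible q e i h → Admissible q e' i' h' → InOrbit q (lam i' h') (lam i h)
Admissible⇒InOrbit {q} {e} {e'} {i} {ℕ.suc k} {i'} {h'} e∼e'
  (_ , ℕ.s≤s ℕ.z≤n , h≤q∸1 , _ , _ , e∼X) (_ , _ , h'≤q∸1 , _ , _ , e'∼X') =
  IsEigenExp⇒lam-InOrbit h≤q (∸1-≤ h'≤q∸1) X∼X'
  where
  X X' : ℤ
  X = twistExponent q i (ℕ.suc k)
  X' = twistExponent q i' h'
  ∸1-≤ : ∀ {m} → m ≤ q ℕ.∸ 1 → m ≤ q
  ∸1-≤ m≤q∸1 = ℕP.≤-trans m≤q∸1 (ℕP.m∸n≤m q 1)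
  h≤q : ℕ.suc k ≤ q
  h≤q = ∸1-≤ h≤q∸1
  1≤q : 1 ≤ q
  1≤q = ℕP.≤-trans (ℕ.s≤s ℕ.z≤n) h≤q
  X∼X' : IsEigenExp q X X'
  X∼X' = IsEigenExp-trans 1≤q {X} {e'} {X'}
           (IsEigenExp-trans 1≤q {X} {e} {e'} (IsEigenExp-sym 1≤q {e} {X} e∼X) e∼e') e'∼X'

mainTheorem12 : (p f : ℕ) → Prime p → 1 ≤ f →
    (e e' : ℤ) → NotInFq (p ^ f) e →
    IsEigenExp (p ^ f) e e' →
    (i h i' h' : ℕ) →
    Admissible (p ^ f) e i h → Admissible (p ^ f) e' i' h' →
    (μ : Char) → InOrbit (p ^ f) μ (lam i h) ⇔ InOrbit (p ^ f) μ (lam i' h')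
mainTheorem12 p f _ _ e e' _ e∼e' i h i' h' adm adm' μ =
  InOrbit-⇔ {p ^ f} μ (InOrbit-sym {p ^ f} {lam i' h'} {lam i h} (Admissible⇒InOrbit e∼e' adm adm'))
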